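{- Let $k \ge 0$ and $r \ge k+2$ be integers, and let $G$ be a connected graph with $\alpha_{k,L}(G) \le r-1$. Then \[ \alpha_k(G) \le \gamma_{r+k-1}(G). \]
   Context: All graphs are finite, simple and undirected. For an integer $k \ge 0$, a set $S \subseteq V(G)$ is $k$-independent if the induced subgraph $G[S]$ has maximum degree at most $k$; $\alpha_k(G)$ is the maximum cardinality of a $k$-independent set of $G$. The local $k$-independence number is $\alpha_{k,L}(G) = \max_{v \in V(G)} \alpha_k(G[N(v)])$, where $N(v)$ is the open neighborhood of $v$. For an integer $j \ge 1$, a $j$-dominating set of $G$ is a set $S \subseteq V(G)$ such that every vertex not in $S$ has at least $j$ neighbors in $S$; $\gamma_j(G)$ is the minimum cardinality of a $j$-dominating set of $G$. -}

module Defs where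

open import Data.Nat using (ℕ; _≤_)
open import Data.Bool using (Bool; true; false)
open import Data.Fin using (Fin)
open import Data.Fin.Subset using (Subset; _∈_; _∉_; _⊆_; _∩_; ∣_∣)
open import Data.Vec using (tabulate)
open import Relation.Binary.PropositionalEquality using (_≡_)

record Graph (n : ℕ) : Set where
  field
    adj   : Fin n → Fin n → Bool
    sym   : ∀ u v → adj u v ≡ adj v u
    irrefl : ∀ v → adj v v ≡ false
open Graph public

module _ {n : ℕ} (G : Graph n) where

  N : Fin n → Subset n
  N v = tabulate (adj G v)

  degIn : Subset n → Fin n → ℕ
  degIn S v = ∣ N v ∩ S ∣

  IsKIndependent : ℕ → Subset n → Set
  IsKIndependent k S = ∀ v → v ∈ S → degIn S v ≤ k

  IsJDominating : ℕ → Subset n → Set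
  IsJDominating j S = ∀ v → v ∉ S → j ≤ ∣ N v ∩ S ∣

  data Reach : Fin n → Fin n → Set where
    here : ∀ {u} → Reach u u
    step : ∀ {u v w} → adj G u v ≡ true → Reach v w → Reach u w

  Connected : Set
  Connected = ∀ u v → Reach u v

  αk≤ : ℕ → ℕ → Set
  αk≤ k m = ∀ S → IsKIndependent k S → ∣ S ∣ ≤ m

  -- α_{k,L}(G) ≤ m, i.e. for every v, α_k(G[N(v)]) ≤ m.
  -- A subset S ⊆ N(v) is k-independent in G[N(v)] iff it is k-independent
  -- in G, since G[N(v)][S] = G[S].
  αkL≤ : ℕ → ℕ → Set
  αkL≤ k m = ∀ v S → S ⊆ N v → IsKIndependent k S → ∣ S ∣ ≤ m

  -- α_k(G) ≤ γ_j(G): every k-independent set is no larger than every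
  -- j-dominating set (max ≤ min)
  αk≤γj : ℕ → ℕ → Set
  αk≤γj k j = ∀ S D → IsKIndependent k S → IsJDominating j D → ∣ S ∣ ≤ ∣ D ∣

-- Let D be (c + k)-dominating and S be k-independent, and count the edges
-- between S ∖ D and D ∖ S.  A vertex of S ∖ D has at least c + k neighbours
-- in D, of which at most k lie in S, so it sends at least c edges to D ∖ S.
-- A vertex w of D ∖ S has at most c neighbours in S, since they form a
-- k-independent subset of N(w).  Hence c ∣S ∖ D∣ ≤ c ∣D ∖ S∣, and adding
-- ∣S ∩ D∣ to both sides gives ∣S∣ ≤ ∣D∣.
module Submission where

open import Defs hiding (sym)
open import Data.Nat using (ℕ; _≤_; _+_; _∸_; zero; suc; _*_; s≤s; NonZero)
open import Data.Nat.Properties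
  using (+-comm; +-suc; +-mono-≤; +-monoʳ-≤; +-cancelʳ-≤; *-identityʳ;
         *-zeroʳ; *-cancelˡ-≤; ≤-refl; ≤-trans; ≤-reflexive; m≤n+m; +-*-semiring;
         module ≤-Reasoning)
open import Data.Nat.Tactic.RingSolver using (solve-∀)
open import Data.Bool using (true; false; if_then_else_; _∧_)
open import Data.Fin using (Fin)
open import Data.Fin.Subset using (Subset; inside; outside; _∈_; _∉_; _⊆_; _∩_; ∁; ∣_∣)
open import Data.Fin.Subset.Properties
  using (_∈?_; x∈p∩q⁺; x∈p∩q⁻; p∩q⊆p; p∩q⊆q; p⊆q⇒∣p∣≤∣q∣; ∩-assoc; ∩-comm;
         x∈∁p⇒x∉p)
open import Data.Vec using ([]; _∷_; lookup; here; there)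
open import Data.Vec.Properties using (lookup-zipWith; lookup∘tabulate)
open import Data.Product using (_,_)
open import Relation.Nullary using (yes; no; contradiction)
open import Relation.Binary.PropositionalEquality
  using (_≡_; refl; sym; trans; cong; subst)
open import Algebra.Properties.Semiring.Sum +-*-semiring
  using (sum; sum-syntax; sum-cong-≗; ∑-comm; *-distribˡ-sum)

∩-mono-⊆ : ∀ {n} {p p′ q q′ : Subset n} → p ⊆ p′ → q ⊆ q′ → p ∩ q ⊆ p′ ∩ q′
∩-mono-⊆ {p = p} {q = q} p⊆p′ q⊆q′ x∈p∩q with x∈p∩q⁻ p q x∈p∩q
... | x∈p , x∈q = x∈p∩q⁺ (p⊆p′ x∈p , q⊆q′ x∈q)

∣p∩q∣≤∣p∩r∣ : ∀ {n} (p : Subset n) {q r} → q ⊆ r → ∣ p ∩ q ∣ ≤ ∣ p ∩ r ∣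
∣p∩q∣≤∣p∩r∣ p q⊆r = p⊆q⇒∣p∣≤∣q∣ (∩-mono-⊆ {p = p} (λ x∈p → x∈p) q⊆r)

∣p∣≡∣p∩q∣+∣p∩∁q∣ : ∀ {n} (p q : Subset n) → ∣ p ∣ ≡ ∣ p ∩ q ∣ + ∣ p ∩ ∁ q ∣
∣p∣≡∣p∩q∣+∣p∩∁q∣ []            []            = refl
∣p∣≡∣p∩q∣+∣p∩∁q∣ (inside ∷ p)  (inside ∷ q)  = cong suc (∣p∣≡∣p∩q∣+∣p∩∁q∣ p q)
∣p∣≡∣p∩q∣+∣p∩∁q∣ (inside ∷ p)  (outside ∷ q) =
  trans (cong suc (∣p∣≡∣p∩q∣+∣p∩∁q∣ p q)) (sym (+-suc _ _))
∣p∣≡∣p∩q∣+∣p∩∁q∣ (outside ∷ p) (_ ∷ q)       = ∣p∣≡∣p∩q∣+∣p∩∁q∣ p q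

∣p∩q∣≤∣p∩[q∩∁s]∣+∣p∩s∣ : ∀ {n} (p q s : Subset n) →
  ∣ p ∩ q ∣ ≤ ∣ p ∩ (q ∩ ∁ s) ∣ + ∣ p ∩ s ∣
∣p∩q∣≤∣p∩[q∩∁s]∣+∣p∩s∣ p q s = begin
  ∣ p ∩ q ∣                            ≡⟨ ∣p∣≡∣p∩q∣+∣p∩∁q∣ (p ∩ q) s ⟩
  ∣ (p ∩ q) ∩ s ∣ + ∣ (p ∩ q) ∩ ∁ s ∣  ≡⟨ +-comm ∣ (p ∩ q) ∩ s ∣ _ ⟩
  ∣ (p ∩ q) ∩ ∁ s ∣ + ∣ (p ∩ q) ∩ s ∣  ≤⟨ +-mono-≤ (≤-reflexive (cong ∣_∣ (∩-assoc p q (∁ s))))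
                                              (p⊆q⇒∣p∣≤∣q∣ {p = (p ∩ q) ∩ s} (∩-mono-⊆ (p∩q⊆p p q) (λ x∈s → x∈s))) ⟩
  ∣ p ∩ (q ∩ ∁ s) ∣ + ∣ p ∩ s ∣        ∎
  where open ≤-Reasoning

χ : ∀ {n} → Subset n → Fin n → ℕ
χ p i = if lookup p i then 1 else 0

χ-∈ : ∀ {n} {p : Subset n} {i} → i ∈ p → χ p i ≡ 1
χ-∈ here        = refl
χ-∈ (there i∈p) = χ-∈ i∈p

χ-∉ : ∀ {n} {p : Subset n} {i} → i ∉ p → χ p i ≡ 0
χ-∉ {p = inside ∷ p}  {Fin.zero}  i∉p = contradiction here i∉p
χ-∉ {p = outside ∷ p} {Fin.zero}  i∉p = refl
χ-∉ {p = _ ∷ p}       {Fin.suc i} i∉p = χ-∉ (λ i∈p → i∉p (there i∈p))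

χ-∩ : ∀ {n} (p q : Subset n) i → χ (p ∩ q) i ≡ χ p i * χ q i
χ-∩ p q i rewrite lookup-zipWith _∧_ i p q with lookup p i | lookup q i
... | true  | true  = refl
... | true  | false = refl
... | false | _     = refl

∣p∣≡∑χ : ∀ {n} (p : Subset n) → ∣ p ∣ ≡ ∑[ i < n ] χ p i
∣p∣≡∑χ []            = refl
∣p∣≡∑χ (inside ∷ p)  = cong suc (∣p∣≡∑χ p)
∣p∣≡∑χ (outside ∷ p) = ∣p∣≡∑χ p

∑-mono-≤ : ∀ {n} {f g : Fin n → ℕ} → (∀ i → f i ≤ g i) → sum f ≤ sum g
∑-mono-≤ {zero}  f≤g = ≤-refl
∑-mono-≤ {suc n} f≤g = +-mono-≤ (f≤g Fin.zero) (∑-mono-≤ (λ i → f≤g (Fin.suc i)))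

module _ {n : ℕ} (p : Subset n) (c : ℕ) (f : Fin n → ℕ) where

  c*∣p∣≡∑c*χ : c * ∣ p ∣ ≡ ∑[ i < n ] (c * χ p i)
  c*∣p∣≡∑c*χ = trans (cong (c *_) (∣p∣≡∑χ p)) (*-distribˡ-sum c (χ p))

  c*∣p∣≤∑χ*f : (∀ i → i ∈ p → c ≤ f i) → c * ∣ p ∣ ≤ ∑[ i < n ] (χ p i * f i)
  c*∣p∣≤∑χ*f c≤f = subst (_≤ _) (sym c*∣p∣≡∑c*χ) (∑-mono-≤ bound)
    where
    bound : ∀ i → c * χ p i ≤ χ p i * f i
    bound i with i ∈? p
    ... | yes i∈p rewrite χ-∈ i∈p | *-identityʳ c | +-comm (f i) 0 = c≤f i i∈p
    ... | no  i∉p rewrite χ-∉ i∉p | *-zeroʳ c = ≤-refl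

  ∑χ*f≤c*∣p∣ : (∀ i → i ∈ p → f i ≤ c) → ∑[ i < n ] (χ p i * f i) ≤ c * ∣ p ∣
  ∑χ*f≤c*∣p∣ f≤c = subst (_ ≤_) (sym c*∣p∣≡∑c*χ) (∑-mono-≤ bound)
    where
    bound : ∀ i → χ p i * f i ≤ c * χ p i
    bound i with i ∈? p
    ... | yes i∈p rewrite χ-∈ i∈p | *-identityʳ c | +-comm (f i) 0 = f≤c i i∈p
    ... | no  i∉p rewrite χ-∉ i∉p | *-zeroʳ c = ≤-refl

module _ {n : ℕ} (G : Graph n) where

  χN-sym : ∀ v w → χ (N G v) w ≡ χ (N G w) v
  χN-sym v w rewrite lookup∘tabulate (adj G v) w | lookup∘tabulate (adj G w) v
                   | Graph.sym G v w = refl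

  ∣N∩p∣≡∑χN*χ : ∀ v (p : Subset n) → ∣ N G v ∩ p ∣ ≡ ∑[ w < n ] (χ (N G v) w * χ p w)
  ∣N∩p∣≡∑χN*χ v p = trans (∣p∣≡∑χ (N G v ∩ p)) (sum-cong-≗ (χ-∩ (N G v) p))

  ∑χ*∣N∩∣-sym : ∀ (p q : Subset n) →
    ∑[ v < n ] (χ p v * ∣ N G v ∩ q ∣) ≡ ∑[ w < n ] (χ q w * ∣ N G w ∩ p ∣)
  ∑χ*∣N∩∣-sym p q = begin
    ∑[ v < n ] (χ p v * ∣ N G v ∩ q ∣)
      ≡⟨ sum-cong-≗ (λ v → cong (χ p v *_) (∣N∩p∣≡∑χN*χ v q)) ⟩
    ∑[ v < n ] (χ p v * ∑[ w < n ] (χ (N G v) w * χ q w))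
      ≡⟨ sum-cong-≗ (λ v → *-distribˡ-sum (χ p v) (λ w → χ (N G v) w * χ q w)) ⟩
    ∑[ v < n ] ∑[ w < n ] (χ p v * (χ (N G v) w * χ q w))
      ≡⟨ ∑-comm (λ v w → χ p v * (χ (N G v) w * χ q w)) ⟩
    ∑[ w < n ] ∑[ v < n ] (χ p v * (χ (N G v) w * χ q w))
      ≡⟨ sum-cong-≗ (λ w → sum-cong-≗ (λ v →
           trans (*-rotate (χ p v) (χ (N G v) w) (χ q w)) (cong (λ b → χ q w * (b * χ p v)) (χN-sym v w)))) ⟩
    ∑[ w < n ] ∑[ v < n ] (χ q w * (χ (N G w) v * χ p v))
      ≡⟨ sum-cong-≗ (λ w → sym (*-distribˡ-sum (χ q w) (λ v → χ (N G w) v * χ p v))) ⟩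
    ∑[ w < n ] (χ q w * ∑[ v < n ] (χ (N G w) v * χ p v))
      ≡⟨ sum-cong-≗ (λ w → cong (χ q w *_) (sym (∣N∩p∣≡∑χN*χ w p))) ⟩
    ∑[ w < n ] (χ q w * ∣ N G w ∩ p ∣) ∎
    where
    open Relation.Binary.PropositionalEquality.≡-Reasoning
    *-rotate : ∀ a b c → a * (b * c) ≡ c * (b * a)
    *-rotate = solve-∀

  ∣p∣≤∣q∣-by-double-counting : ∀ (p q : Subset n) c .{{_ : NonZero c}} →
    (∀ v → v ∈ p → c ≤ ∣ N G v ∩ q ∣) → (∀ w → w ∈ q → ∣ N G w ∩ p ∣ ≤ c) →
    ∣ p ∣ ≤ ∣ q ∣
  ∣p∣≤∣q∣-by-double-counting p q c out≥c in≤c = *-cancelˡ-≤ c (begin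
    c * ∣ p ∣                            ≤⟨ c*∣p∣≤∑χ*f p c (λ v → ∣ N G v ∩ q ∣) out≥c ⟩
    ∑[ v < n ] (χ p v * ∣ N G v ∩ q ∣)   ≡⟨ ∑χ*∣N∩∣-sym p q ⟩
    ∑[ w < n ] (χ q w * ∣ N G w ∩ p ∣)   ≤⟨ ∑χ*f≤c*∣p∣ q c (λ w → ∣ N G w ∩ p ∣) in≤c ⟩
    c * ∣ q ∣                            ∎)
    where open ≤-Reasoning

  IsKIndependent-⊆ : ∀ {k} {S T : Subset n} → T ⊆ S → IsKIndependent G k S → IsKIndependent G k T
  IsKIndependent-⊆ T⊆S indS v v∈T =
    ≤-trans (∣p∩q∣≤∣p∩r∣ (N G v) T⊆S) (indS v (T⊆S v∈T))

  αkL≤⇒αk≤γj : ∀ k c .{{_ : NonZero c}} → αkL≤ G k c → αk≤γj G k (c + k)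
  αkL≤⇒αk≤γj k c αkL≤c S D indS domD = begin
    ∣ S ∣                        ≡⟨ ∣p∣≡∣p∩q∣+∣p∩∁q∣ S D ⟩
    ∣ S ∩ D ∣ + ∣ S ∩ ∁ D ∣      ≤⟨ +-mono-≤ (≤-reflexive (cong ∣_∣ (∩-comm S D))) S∖D≤D∖S ⟩
    ∣ D ∩ S ∣ + ∣ D ∩ ∁ S ∣      ≡⟨ sym (∣p∣≡∣p∩q∣+∣p∩∁q∣ D S) ⟩
    ∣ D ∣                        ∎
    where
    open ≤-Reasoning
    S∖D≤D∖S : ∣ S ∩ ∁ D ∣ ≤ ∣ D ∩ ∁ S ∣
    S∖D≤D∖S = ∣p∣≤∣q∣-by-double-counting (S ∩ ∁ D) (D ∩ ∁ S) c out≥c in≤c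
      where
      out≥c : ∀ v → v ∈ S ∩ ∁ D → c ≤ ∣ N G v ∩ (D ∩ ∁ S) ∣
      out≥c v v∈S∖D with x∈p∩q⁻ S (∁ D) v∈S∖D
      ... | v∈S , v∈∁D = +-cancelʳ-≤ k c _ (begin
        c + k                                  ≤⟨ domD v (x∈∁p⇒x∉p v∈∁D) ⟩
        ∣ N G v ∩ D ∣                          ≤⟨ ∣p∩q∣≤∣p∩[q∩∁s]∣+∣p∩s∣ (N G v) D S ⟩
        ∣ N G v ∩ (D ∩ ∁ S) ∣ + ∣ N G v ∩ S ∣  ≤⟨ +-monoʳ-≤ _ (indS v v∈S) ⟩
        ∣ N G v ∩ (D ∩ ∁ S) ∣ + k              ∎)
      in≤c : ∀ w → w ∈ D ∩ ∁ S → ∣ N G w ∩ (S ∩ ∁ D) ∣ ≤ c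
      in≤c w _ = begin
        ∣ N G w ∩ (S ∩ ∁ D) ∣  ≤⟨ ∣p∩q∣≤∣p∩r∣ (N G w) (p∩q⊆p S (∁ D)) ⟩
        ∣ N G w ∩ S ∣          ≤⟨ αkL≤c w (N G w ∩ S) (p∩q⊆p (N G w) S)
                                   (IsKIndependent-⊆ (p∩q⊆q (N G w) S) indS) ⟩
        c                      ∎

theorem3 : (n k r : ℕ) (G : Graph n) → k + 2 ≤ r → Connected G →
    αkL≤ G k (r ∸ 1) → αk≤γj G k (r + k ∸ 1)
theorem3 n k r G k+2≤r _ hL with ≤-trans (m≤n+m 2 k) k+2≤r
... | s≤s (s≤s _) = αkL≤⇒αk≤γj G k _ hL
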